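{- Fix an integer $r\ge 10$. For $n\ge 4r$ let $G=(V,W,E)$ be the random bipartite graph with $|V|=|W|=n$ obtained by choosing, independently and uniformly at random for each $v\in V$, a set of $r$ distinct neighbors in $W$. Then, as $n\to\infty$, with probability tending to $1$ there are no distinct vertices $v_1,v_2 \in V$ with $|N(v_1) \cap N(v_2)| \geq 3$. -}

module Defs where

open import Data.Nat using (ℕ; zero; suc; _≤_; _≤?_; _≟_)
open import Data.Fin using (Fin)
import Data.Fin.Properties as FinP
open import Data.Fin.Subset using (Subset; inside; outside; ∣_∣; _∩_)
open import Data.List using (List; []; _∷_; [_]; map; _++_; concatMap; filter; length)
open import Data.Vec using (Vec; lookup) renaming ([] to []ᵥ; _∷_ to _∷ᵥ_)
open import Data.Product using (∃-syntax; _×_)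
open import Relation.Binary.PropositionalEquality using (_≢_)
open import Relation.Nullary using (Dec; ¬?)
open import Relation.Nullary.Decidable using (_×-dec_)

allSubsets : (n : ℕ) → List (Subset n)
allSubsets zero = [ []ᵥ ]
allSubsets (suc n) = map (inside ∷ᵥ_) ss ++ map (outside ∷ᵥ_) ss
  where ss = allSubsets n

rSubsets : (r n : ℕ) → List (Subset n)
rSubsets r n = filter (λ s → ∣ s ∣ ≟ r) (allSubsets n)

allVecs : {A : Set} → List A → (m : ℕ) → List (Vec A m)
allVecs L zero = [ []ᵥ ]
allVecs L (suc m) = concatMap (λ x → map (x ∷ᵥ_) (allVecs L m)) L

-- A graph G = (V, W, E) with V = W = Fin n is given by the neighbourhoods N(v) ⊆ W, v ∈ V.
BipGraph : ℕ → Set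
BipGraph n = Vec (Subset n) n

-- The sample space: every v ∈ V chooses an r-subset of W; the uniform distribution on
-- this list is exactly the random graph of the statement.
configs : (r n : ℕ) → List (BipGraph n)
configs r n = allVecs (rSubsets r n) n

Bad : {n : ℕ} → BipGraph n → Set
Bad {n} G = ∃[ v₁ ] ∃[ v₂ ] (v₁ ≢ v₂ × 3 ≤ ∣ lookup G v₁ ∩ lookup G v₂ ∣)

bad? : {n : ℕ} → (G : BipGraph n) → Dec (Bad G)
bad? G = FinP.any? λ v₁ → FinP.any? λ v₂ →
  ¬? (v₁ FinP.≟ v₂) ×-dec (3 ≤? ∣ lookup G v₁ ∩ lookup G v₂ ∣)

badCount : (r n : ℕ) → ℕ
badCount r n = length (filter bad? (configs r n))

totalCount : (r n : ℕ) → ℕ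
totalCount r n = length (configs r n)

module Submission where

-- A graph is an n-tuple of r-subsets of W = Fin n, drawn uniformly from the
-- M^n tuples, where M = n C r.  We bound the bad outcomes by a union bound
-- over pairs: if every r-set A has at most D "partners" B (r-sets with
-- |A ∩ B| ≥ 3), then at most n² · D · M^(n-1) tuples contain a partner pair.
-- Choosing the three common points first gives D ≤ (r C 3) · ((n-3) C (r-3)),
-- and the absorption identity  (n C r) · r(r-1)(r-2) = n(n-1)(n-2) · ((n-3) C (r-3))
-- turns this into  bad/total ≤ n · c₀ / ((n-1)(n-2))  with c₀ depending only on r,
-- which is below 1/(k+1) as soon as n ≥ 3 + (k+1) c₀.  The argument needs only
-- r ≥ 3 and n ≥ r, so the hypotheses r ≥ 10 and n ≥ 4r of lemma11 are used
-- only through these consequences.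

open import Defs
open import Data.Bool using (Bool; true; false; T; _∧_; _∨_)
open import Data.Bool.Properties using (∧-identityʳ; T-∧; T-∨)
open import Data.Empty using (⊥-elim)
open import Data.Fin using () renaming (zero to fzero; suc to fsuc)
open import Data.Fin.Subset using (Subset; inside; outside; ∣_∣; _∩_)
open import Data.Fin.Subset.Properties using (∣p∩q∣≤∣q∣; ∣p∣≤n; ∩-comm)
open import Data.List using (List; []; _∷_; map; _++_; concatMap; filter; length)
open import Data.List.Relation.Unary.All using (All; []; _∷_; universal) renaming (map to All-map)
open import Data.List.Relation.Unary.All.Properties using (all-filter)
open import Data.Nat
open import Data.Nat.Properties
open import Data.Nat.Combinatorics using (_C_; nCk+nC[k+1]≡[n+1]C[k+1]; nC1≡n; k>n⇒nCk≡0)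
open import Data.Nat.Tactic.RingSolver using (solve-∀)
open import Algebra.Properties.CommutativeSemigroup +-commutativeSemigroup using () renaming (interchange to +-interchange)
open import Data.Product using (∃-syntax; _,_)
open import Data.Sum using (inj₁; inj₂)
open import Data.Vec using (Vec; lookup) renaming ([] to []ᵥ; _∷_ to _∷ᵥ_)
open import Function.Bundles using (Equivalence)
open import Relation.Binary.PropositionalEquality
open import Relation.Nullary using (Dec; yes; no; does; ¬_)

private
  variable
    A B : Set

-- Probabilities on a finite uniform space are handled as counts over lists.

∑ : List A → (A → ℕ) → ℕ
∑ [] f = 0
∑ (x ∷ xs) f = f x + ∑ xs f

syntax ∑ xs (λ x → e) = ∑[ x ∈ xs ] e

𝟙 : Bool → ℕ
𝟙 true = 1
𝟙 false = 0

count : (A → Bool) → List A → ℕ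
count p xs = ∑[ x ∈ xs ] 𝟙 (p x)

∑-cong : ∀ {f g : A → ℕ} → (∀ x → f x ≡ g x) → ∀ xs → ∑ xs f ≡ ∑ xs g
∑-cong f≡g [] = refl
∑-cong f≡g (x ∷ xs) = cong₂ _+_ (f≡g x) (∑-cong f≡g xs)

∑-mono : ∀ {f g : A → ℕ} {xs} → All (λ x → f x ≤ g x) xs → ∑ xs f ≤ ∑ xs g
∑-mono [] = z≤n
∑-mono (fx≤gx ∷ f≤g) = +-mono-≤ fx≤gx (∑-mono f≤g)

∑-mono-∀ : ∀ {f g : A → ℕ} → (∀ x → f x ≤ g x) → ∀ xs → ∑ xs f ≤ ∑ xs g
∑-mono-∀ f≤g xs = ∑-mono (universal f≤g xs)

∑-+ : ∀ (f g : A → ℕ) xs → ∑[ x ∈ xs ] (f x + g x) ≡ ∑ xs f + ∑ xs g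
∑-+ f g [] = refl
∑-+ f g (x ∷ xs) = trans (cong (f x + g x +_) (∑-+ f g xs)) (+-interchange (f x) (g x) (∑ xs f) (∑ xs g))

∑-*ˡ : ∀ c (f : A → ℕ) xs → ∑[ x ∈ xs ] (c * f x) ≡ c * ∑ xs f
∑-*ˡ c f [] = sym (*-zeroʳ c)
∑-*ˡ c f (x ∷ xs) = trans (cong (c * f x +_) (∑-*ˡ c f xs)) (sym (*-distribˡ-+ c (f x) (∑ xs f)))

∑-const : ∀ c (xs : List A) → ∑[ x ∈ xs ] c ≡ length xs * c
∑-const c [] = refl
∑-const c (x ∷ xs) = cong (c +_) (∑-const c xs)

∑-++ : ∀ (f : A → ℕ) xs ys → ∑ (xs ++ ys) f ≡ ∑ xs f + ∑ ys f
∑-++ f [] ys = refl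
∑-++ f (x ∷ xs) ys = trans (cong (f x +_) (∑-++ f xs ys)) (sym (+-assoc (f x) (∑ xs f) (∑ ys f)))

∑-map : ∀ (f : B → ℕ) (g : A → B) xs → ∑ (map g xs) f ≡ ∑[ x ∈ xs ] f (g x)
∑-map f g [] = refl
∑-map f g (x ∷ xs) = cong (f (g x) +_) (∑-map f g xs)

∑-concatMap : ∀ (f : B → ℕ) (g : A → List B) xs → ∑ (concatMap g xs) f ≡ ∑[ x ∈ xs ] ∑ (g x) f
∑-concatMap f g [] = refl
∑-concatMap f g (x ∷ xs) = trans (∑-++ f (g x) (concatMap g xs)) (cong (∑ (g x) f +_) (∑-concatMap f g xs))

length-∑ : (xs : List A) → length xs ≡ ∑[ x ∈ xs ] 1
length-∑ [] = refl
length-∑ (x ∷ xs) = cong suc (length-∑ xs)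

count-mono : ∀ {p q : A → Bool} → (∀ x → T (p x) → T (q x)) → ∀ xs → count p xs ≤ count q xs
count-mono {p = p} {q} p⇒q = ∑-mono-∀ indicator-mono
  where
  indicator-mono : ∀ x → 𝟙 (p x) ≤ 𝟙 (q x)
  indicator-mono x with p x | q x | p⇒q x
  ... | false | _     | _   = z≤n
  ... | true  | true  | _   = ≤-refl
  ... | true  | false | impossible = ⊥-elim (impossible _)

count-none : ∀ {p : A → Bool} → (∀ x → ¬ T (p x)) → ∀ xs → count p xs ≡ 0
count-none none [] = refl
count-none {p = p} none (x ∷ xs) with p x | none x
... | false | _      = count-none none xs
... | true  | ¬px    = ⊥-elim (¬px _)

count-∨ : ∀ (p q : A → Bool) xs → count (λ x → p x ∨ q x) xs ≤ count p xs + count q xs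
count-∨ p q xs = ≤-trans (∑-mono-∀ indicator-∨ xs) (≤-reflexive (∑-+ (λ x → 𝟙 (p x)) (λ x → 𝟙 (q x)) xs))
  where
  indicator-∨ : ∀ x → 𝟙 (p x ∨ q x) ≤ 𝟙 (p x) + 𝟙 (q x)
  indicator-∨ x with p x | q x
  ... | true  | _ = s≤s z≤n
  ... | false | _ = ≤-refl

count-const : ∀ (b : Bool) (xs : List A) → count (λ _ → b) xs ≡ length xs * 𝟙 b
count-const b xs = ∑-const (𝟙 b) xs

length-filter : ∀ {P : A → Set} (P? : ∀ x → Dec (P x)) xs → length (filter P? xs) ≡ count (λ x → does (P? x)) xs
length-filter P? [] = refl
length-filter P? (x ∷ xs) with does (P? x)
... | true  = cong suc (length-filter P? xs)
... | false = length-filter P? xs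

count-filter : ∀ {P : A → Set} (P? : ∀ x → Dec (P x)) (p : A → Bool) xs →
  count p (filter P? xs) ≡ count (λ x → does (P? x) ∧ p x) xs
count-filter P? p [] = refl
count-filter P? p (x ∷ xs) with does (P? x)
... | true  = cong (𝟙 (p x) +_) (count-filter P? p xs)
... | false = count-filter P? p xs

count-∨-∑ : ∀ (f : A → B → Bool) (g : B → Bool) (ys : List A) (vs : List B) →
  ∑[ y ∈ ys ] count (λ v → f y v ∨ g v) vs ≤ ∑[ y ∈ ys ] count (f y) vs + length ys * count g vs
count-∨-∑ f g ys vs = begin
  ∑[ y ∈ ys ] count (λ v → f y v ∨ g v) vs       ≤⟨ ∑-mono-∀ (λ y → count-∨ (f y) g vs) ys ⟩
  ∑[ y ∈ ys ] (count (f y) vs + count g vs)       ≡⟨ ∑-+ (λ y → count (f y) vs) (λ _ → count g vs) ys ⟩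
  ∑[ y ∈ ys ] count (f y) vs + ∑[ y ∈ ys ] count g vs ≡⟨ cong (_ +_) (∑-const (count g vs) ys) ⟩
  ∑[ y ∈ ys ] count (f y) vs + length ys * count g vs ∎
  where open ≤-Reasoning

∑-allVecs-suc : ∀ (L : List A) m (f : Vec A (suc m) → ℕ) →
  ∑ (allVecs L (suc m)) f ≡ ∑[ y ∈ L ] ∑[ v ∈ allVecs L m ] f (y ∷ᵥ v)
∑-allVecs-suc L m f = trans (∑-concatMap f (λ y → map (y ∷ᵥ_) (allVecs L m)) L)
  (∑-cong (λ y → ∑-map f (y ∷ᵥ_) (allVecs L m)) L)

length-allVecs : ∀ (L : List A) m → length (allVecs L m) ≡ length L ^ m
length-allVecs L zero = refl
length-allVecs L (suc m) = begin
  length (allVecs L (suc m))                    ≡⟨ length-∑ (allVecs L (suc m)) ⟩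
  ∑[ v ∈ allVecs L (suc m) ] 1                  ≡⟨ ∑-allVecs-suc L m (λ _ → 1) ⟩
  ∑[ y ∈ L ] ∑[ v ∈ allVecs L m ] 1             ≡⟨ ∑-cong (λ _ → sym (length-∑ (allVecs L m))) L ⟩
  ∑[ y ∈ L ] length (allVecs L m)               ≡⟨ ∑-const _ L ⟩
  length L * length (allVecs L m)               ≡⟨ cong (length L *_) (length-allVecs L m) ⟩
  length L * length L ^ m                       ∎
  where open ≡-Reasoning

∨-introˡ : ∀ {a b} → T a → T (a ∨ b)
∨-introˡ {a} {b} h = Equivalence.from (T-∨ {a} {b}) (inj₁ h)

∨-introʳ : ∀ {a b} → T b → T (a ∨ b)
∨-introʳ {a} {b} h = Equivalence.from (T-∨ {a} {b}) (inj₂ h)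

module Collisions (R : A → A → Bool) (L : List A) where

  hits : ∀ {m} → A → Vec A m → Bool
  hits x []ᵥ = false
  hits x (y ∷ᵥ v) = R x y ∨ hits x v

  collides : ∀ {m} → Vec A m → Bool
  collides []ᵥ = false
  collides (y ∷ᵥ v) = hits y v ∨ collides v

  M : ℕ
  M = length L

  hits-bound : ∀ {x D} → count (R x) L ≤ D → ∀ m → count (hits x) (allVecs L m) * M ≤ m * D * M ^ m
  hits-bound partners zero = z≤n
  hits-bound {x} {D} partners (suc m) = begin
      count (hits x) (allVecs L (suc m)) * M
        ≡⟨ cong (_* M) (∑-allVecs-suc L m (λ v → 𝟙 (hits x v))) ⟩
      (∑[ y ∈ L ] count (λ v → R x y ∨ hits x v) V) * M
        ≤⟨ *-monoˡ-≤ M (count-∨-∑ (λ y _ → R x y) (hits x) L V) ⟩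
      (∑[ y ∈ L ] count (λ _ → R x y) V + M * c) * M
        ≡⟨ cong (λ z → (z + M * c) * M) first-entry ⟩
      (M ^ m * count (R x) L + M * c) * M
        ≤⟨ *-monoˡ-≤ M (+-monoˡ-≤ (M * c) (*-monoʳ-≤ (M ^ m) partners)) ⟩
      (M ^ m * D + M * c) * M
        ≡⟨ expand (M ^ m) D M c ⟩
      M ^ m * D * M + M * (c * M)
        ≤⟨ +-monoʳ-≤ (M ^ m * D * M) (*-monoʳ-≤ M (hits-bound partners m)) ⟩
      M ^ m * D * M + M * (m * D * M ^ m)
        ≡⟨ collect (M ^ m) D M m ⟩
      suc m * D * M ^ suc m ∎
    where
    open ≤-Reasoning
    V = allVecs L m
    c = count (hits x) V
    first-entry : ∑[ y ∈ L ] count (λ _ → R x y) V ≡ M ^ m * count (R x) L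
    first-entry = begin-equality
      ∑[ y ∈ L ] count (λ _ → R x y) V   ≡⟨ ∑-cong (λ y → count-const (R x y) V) L ⟩
      ∑[ y ∈ L ] (length V * 𝟙 (R x y))  ≡⟨ ∑-*ˡ (length V) (λ y → 𝟙 (R x y)) L ⟩
      length V * count (R x) L           ≡⟨ cong (_* count (R x) L) (length-allVecs L m) ⟩
      M ^ m * count (R x) L              ∎
    expand : ∀ a D M c → (a * D + M * c) * M ≡ a * D * M + M * (c * M)
    expand = solve-∀
    collect : ∀ a D M m → a * D * M + M * (m * D * a) ≡ suc m * D * (M * a)
    collect = solve-∀

  collides-bound : ∀ {D} → All (λ x → count (R x) L ≤ D) L → ∀ m →
    count collides (allVecs L m) * M ≤ m * m * D * M ^ m
  collides-bound partners zero = z≤n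
  collides-bound {D} partners (suc m) = begin
      count collides (allVecs L (suc m)) * M
        ≡⟨ cong (_* M) (∑-allVecs-suc L m (λ v → 𝟙 (collides v))) ⟩
      (∑[ y ∈ L ] count (λ v → hits y v ∨ collides v) V) * M
        ≤⟨ *-monoˡ-≤ M (count-∨-∑ hits collides L V) ⟩
      (S + M * b) * M
        ≡⟨ *-distribʳ-+ M S (M * b) ⟩
      S * M + M * b * M
        ≤⟨ +-mono-≤ hits-part (≤-reflexive (*-assoc M b M)) ⟩
      M * (m * D * M ^ m) + M * (b * M)
        ≤⟨ +-monoʳ-≤ (M * (m * D * M ^ m)) (*-monoʳ-≤ M (collides-bound partners m)) ⟩
      M * (m * D * M ^ m) + M * (m * m * D * M ^ m)
        ≤⟨ m≤m+n _ (M * (suc m * D * M ^ m)) ⟩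
      M * (m * D * M ^ m) + M * (m * m * D * M ^ m) + M * (suc m * D * M ^ m)
        ≡⟨ collect M m D (M ^ m) ⟩
      suc m * suc m * D * M ^ suc m ∎
    where
    open ≤-Reasoning
    V = allVecs L m
    b = count collides V
    S = ∑[ y ∈ L ] count (hits y) V
    hits-part : S * M ≤ M * (m * D * M ^ m)
    hits-part = begin
      S * M                                 ≡⟨ *-comm S M ⟩
      M * S                                 ≡⟨ ∑-*ˡ M (λ y → count (hits y) V) L ⟨
      ∑[ y ∈ L ] (M * count (hits y) V)     ≡⟨ ∑-cong (λ y → *-comm M (count (hits y) V)) L ⟩
      ∑[ y ∈ L ] (count (hits y) V * M)     ≤⟨ ∑-mono (All-map (λ p → hits-bound p m) partners) ⟩
      ∑[ y ∈ L ] (m * D * M ^ m)            ≡⟨ ∑-const _ L ⟩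
      M * (m * D * M ^ m)                   ∎
    collect : ∀ M m D a → M * (m * D * a) + M * (m * m * D * a) + M * (suc m * D * a) ≡ suc m * suc m * D * (M * a)
    collect = solve-∀

  hits-lookup : ∀ {m} x (v : Vec A m) j → T (R x (lookup v j)) → T (hits x v)
  hits-lookup x (y ∷ᵥ v) fzero    h = ∨-introˡ h
  hits-lookup x (y ∷ᵥ v) (fsuc j) h = ∨-introʳ {R x y} (hits-lookup x v j h)

  collides-complete : (∀ x y → R x y ≡ R y x) → ∀ {m} (v : Vec A m) i j → i ≢ j →
    T (R (lookup v i) (lookup v j)) → T (collides v)
  collides-complete R-sym (y ∷ᵥ v) fzero fzero i≢j h = ⊥-elim (i≢j refl)
  collides-complete R-sym (y ∷ᵥ v) fzero (fsuc j) i≢j h = ∨-introˡ (hits-lookup y v j h)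
  collides-complete R-sym (y ∷ᵥ v) (fsuc i) fzero i≢j h = ∨-introˡ (hits-lookup y v i (subst T (R-sym _ _) h))
  collides-complete R-sym (y ∷ᵥ v) (fsuc i) (fsuc j) i≢j h =
    ∨-introʳ {hits y v} (collides-complete R-sym v i j (λ i≡j → i≢j (cong fsuc i≡j)) h)

pascal : ∀ n k → n C k + n C suc k ≡ suc n C suc k
pascal = nCk+nC[k+1]≡[n+1]C[k+1]

C-pos : ∀ {n k} → k ≤ n → 0 < n C k
C-pos {k = zero} _ = s≤s z≤n
C-pos {suc n} {suc k} (s≤s k≤n) = ≤-trans (C-pos k≤n) (≤-trans (m≤m+n _ _) (≤-reflexive (pascal n k)))

C-monoˡ : ∀ k {m n} → m ≤ n → m C k ≤ n C k
C-monoˡ zero _ = ≤-refl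
C-monoˡ (suc k) z≤n = z≤n
C-monoˡ (suc k) {suc m} {suc n} (s≤s m≤n) = begin
  suc m C suc k     ≡⟨ pascal m k ⟨
  m C k + m C suc k ≤⟨ +-mono-≤ (C-monoˡ k m≤n) (C-monoˡ (suc k) m≤n) ⟩
  n C k + n C suc k ≡⟨ pascal n k ⟩
  suc n C suc k     ∎
  where open ≤-Reasoning

-- Absorption: choosing a (k+1)-set with a marked element.
C-absorb : ∀ n k → (suc n C suc k) * suc k ≡ suc n * (n C k)
C-absorb zero zero = refl
C-absorb zero (suc k) = refl
C-absorb (suc n) zero = begin
  (suc (suc n) C 1) * 1 ≡⟨ *-identityʳ _ ⟩
  suc (suc n) C 1     ≡⟨ nC1≡n (suc (suc n)) ⟩
  suc (suc n)         ≡⟨ *-identityʳ _ ⟨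
  suc (suc n) * 1     ∎
  where open ≡-Reasoning
C-absorb (suc n) (suc k) = begin
  (suc (suc n) C suc (suc k)) * suc (suc k)
    ≡⟨ cong (_* suc (suc k)) (pascal (suc n) (suc k)) ⟨
  (X + Y) * suc (suc k)
    ≡⟨ split X Y k ⟩
  X * suc k + X + Y * suc (suc k)
    ≡⟨ cong₂ (λ u v → u + X + v) (C-absorb n k) (C-absorb n (suc k)) ⟩
  suc n * (n C k) + X + suc n * (n C suc k)
    ≡⟨ cong (λ u → suc n * (n C k) + u + suc n * (n C suc k)) (pascal n k) ⟨
  suc n * (n C k) + (n C k + n C suc k) + suc n * (n C suc k)
    ≡⟨ merge n (n C k) (n C suc k) ⟩
  suc (suc n) * (n C k + n C suc k)
    ≡⟨ cong (suc (suc n) *_) (pascal n k) ⟩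
  suc (suc n) * X ∎
  where
  open ≡-Reasoning
  X = suc n C suc k
  Y = suc n C suc (suc k)
  split : ∀ X Y k → (X + Y) * (2 + k) ≡ X * (1 + k) + X + Y * (2 + k)
  split = solve-∀
  merge : ∀ n a b → (1 + n) * a + (a + b) + (1 + n) * b ≡ (2 + n) * (a + b)
  merge = solve-∀

C-absorb³ : ∀ m s → ((3 + m) C (3 + s)) * ((3 + s) * (2 + s) * (1 + s)) ≡ (3 + m) * (2 + m) * (1 + m) * (m C s)
C-absorb³ m s = begin
  X₃ * ((3 + s) * (2 + s) * (1 + s))    ≡⟨ regroup₁ X₃ (3 + s) (2 + s) (1 + s) ⟩
  X₃ * (3 + s) * ((2 + s) * (1 + s))    ≡⟨ cong (_* ((2 + s) * (1 + s))) (C-absorb (2 + m) (2 + s)) ⟩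
  (3 + m) * X₂ * ((2 + s) * (1 + s))    ≡⟨ regroup₂ (3 + m) X₂ (2 + s) (1 + s) ⟩
  (3 + m) * (X₂ * (2 + s) * (1 + s))    ≡⟨ cong (λ z → (3 + m) * (z * (1 + s))) (C-absorb (1 + m) (1 + s)) ⟩
  (3 + m) * ((2 + m) * X₁ * (1 + s))    ≡⟨ regroup₃ (3 + m) (2 + m) X₁ (1 + s) ⟩
  (3 + m) * (2 + m) * (X₁ * (1 + s))    ≡⟨ cong ((3 + m) * (2 + m) *_) (C-absorb m s) ⟩
  (3 + m) * (2 + m) * ((1 + m) * (m C s)) ≡⟨ *-assoc ((3 + m) * (2 + m)) (1 + m) (m C s) ⟨
  (3 + m) * (2 + m) * (1 + m) * (m C s)   ∎
  where
  open ≡-Reasoning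
  X₃ = (3 + m) C (3 + s)
  X₂ = (2 + m) C (2 + s)
  X₁ = (1 + m) C (1 + s)
  regroup₁ : ∀ X a b c → X * (a * b * c) ≡ X * a * (b * c)
  regroup₁ = solve-∀
  regroup₂ : ∀ u X b c → u * X * (b * c) ≡ u * (X * b * c)
  regroup₂ = solve-∀
  regroup₃ : ∀ u v X c → u * (v * X * c) ≡ u * v * (X * c)
  regroup₃ = solve-∀

count-allSubsets-suc : ∀ n (p : Subset (suc n) → Bool) →
  count p (allSubsets (suc n)) ≡ count (λ B → p (inside ∷ᵥ B)) (allSubsets n) + count (λ B → p (outside ∷ᵥ B)) (allSubsets n)
count-allSubsets-suc n p = trans (∑-++ (λ B → 𝟙 (p B)) (map (inside ∷ᵥ_) (allSubsets n)) (map (outside ∷ᵥ_) (allSubsets n)))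
  (cong₂ _+_ (∑-map (λ B → 𝟙 (p B)) (inside ∷ᵥ_) (allSubsets n)) (∑-map (λ B → 𝟙 (p B)) (outside ∷ᵥ_) (allSubsets n)))

count-size : ∀ n k → count (λ B → ∣ B ∣ ≡ᵇ k) (allSubsets n) ≡ n C k
count-size zero zero = refl
count-size zero (suc k) = refl
count-size (suc n) zero = trans (count-allSubsets-suc n (λ B → ∣ B ∣ ≡ᵇ 0))
  (trans (cong (_+ count (λ B → ∣ B ∣ ≡ᵇ 0) (allSubsets n)) (count-none (λ _ ()) (allSubsets n))) (count-size n zero))
count-size (suc n) (suc k) = trans (count-allSubsets-suc n (λ B → ∣ B ∣ ≡ᵇ suc k))
  (trans (cong₂ _+_ (count-size n k) (count-size n (suc k))) (pascal n k))

length-rSubsets : ∀ r n → length (rSubsets r n) ≡ n C r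
length-rSubsets r n = trans (length-filter (λ B → ∣ B ∣ ≟ r) (allSubsets n)) (count-size n r)

-- overlapCount A k t: the number of k-subsets B with |A ∩ B| ≥ t.  The test
-- t < |A ∩ B| + 1 is used because it is invariant under adding a common point.
overlapCount : ∀ {n} → Subset n → ℕ → ℕ → ℕ
overlapCount {n} A k t = count (λ B → (∣ B ∣ ≡ᵇ k) ∧ (t <ᵇ suc ∣ A ∩ B ∣)) (allSubsets n)

-- A k-set meets A in at most k points.
overlapCount-large : ∀ {n} (A : Subset n) {k t} → k < t → overlapCount A k t ≡ 0
overlapCount-large {n} A {k} {t} k<t = count-none impossible (allSubsets n)
  where
  impossible : ∀ B → ¬ T ((∣ B ∣ ≡ᵇ k) ∧ (t <ᵇ suc ∣ A ∩ B ∣))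
  impossible B both with Equivalence.to T-∧ both
  ... | size , meets = <⇒≱ k<t (begin
    t           ≤⟨ s≤s⁻¹ (<ᵇ⇒< t (suc ∣ A ∩ B ∣) meets) ⟩
    ∣ A ∩ B ∣   ≤⟨ ∣p∩q∣≤∣q∣ A B ⟩
    ∣ B ∣       ≡⟨ ≡ᵇ⇒≡ ∣ B ∣ k size ⟩
    k           ∎)
    where open ≤-Reasoning

-- Removing t+1 instead of t points from Fin n costs a point exactly when t < n;
-- otherwise a set of size ≤ n has no (t+1)-subsets at all.
C-shift : ∀ {a n} t k → a ≤ n → (a C suc t) * (suc (n ∸ suc t) C k) ≤ (a C suc t) * ((n ∸ t) C k)
C-shift {a} {n} t k a≤n with t <? n
... | yes t<n = ≤-reflexive (cong (λ z → (a C suc t) * (z C k)) (sym (+-∸-assoc 1 t<n)))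
... | no t≮n rewrite k>n⇒nCk≡0 {a} {suc t} (s≤s (≤-trans a≤n (≮⇒≥ t≮n))) = z≤n

-- The k-sets with at least t points in A, k = t + s, are at most those obtained by
-- choosing t points of A and s points outside those t.
overlapCount-bound : ∀ {n} (A : Subset n) t s → overlapCount A (t + s) t ≤ (∣ A ∣ C t) * ((n ∸ t) C s)
overlapCount-bound {n} A zero s = ≤-reflexive (begin
  count (λ B → (∣ B ∣ ≡ᵇ s) ∧ true) (allSubsets n) ≡⟨ ∑-cong (λ B → cong 𝟙 (∧-identityʳ (∣ B ∣ ≡ᵇ s))) (allSubsets n) ⟩
  count (λ B → ∣ B ∣ ≡ᵇ s) (allSubsets n)          ≡⟨ count-size n s ⟩
  n C s                                             ≡⟨ +-identityʳ (n C s) ⟨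
  1 * (n C s)                                       ∎)
  where open ≡-Reasoning
overlapCount-bound []ᵥ (suc t) s = z≤n
overlapCount-bound {suc n} (inside ∷ᵥ A) (suc t) s = begin
    overlapCount (inside ∷ᵥ A) (suc t + s) (suc t)
      ≡⟨ count-allSubsets-suc n _ ⟩
    overlapCount A (t + s) t + overlapCount A (suc t + s) (suc t)
      ≤⟨ +-mono-≤ (overlapCount-bound A t s) (overlapCount-bound A (suc t) s) ⟩
    (a C t) * ((n ∸ t) C s) + (a C suc t) * ((n ∸ suc t) C s)
      ≤⟨ +-monoʳ-≤ _ (*-monoʳ-≤ (a C suc t) (C-monoˡ s (∸-monoʳ-≤ n (n≤1+n t)))) ⟩
    (a C t) * ((n ∸ t) C s) + (a C suc t) * ((n ∸ t) C s)
      ≡⟨ *-distribʳ-+ ((n ∸ t) C s) (a C t) (a C suc t) ⟨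
    (a C t + a C suc t) * ((n ∸ t) C s)
      ≡⟨ cong (_* ((n ∸ t) C s)) (pascal a t) ⟩
    (suc a C suc t) * ((n ∸ t) C s) ∎
  where
  open ≤-Reasoning
  a = ∣ A ∣
overlapCount-bound {suc n} (outside ∷ᵥ A) (suc t) zero = begin
    overlapCount (outside ∷ᵥ A) (suc t + 0) (suc t)
      ≡⟨ count-allSubsets-suc n _ ⟩
    overlapCount A (t + 0) (suc t) + overlapCount A (suc t + 0) (suc t)
      ≡⟨ cong (_+ overlapCount A (suc t + 0) (suc t)) (overlapCount-large A (s≤s (≤-reflexive (+-identityʳ t)))) ⟩
    overlapCount A (suc t + 0) (suc t)
      ≤⟨ overlapCount-bound A (suc t) zero ⟩
    (∣ A ∣ C suc t) * 1 ∎
  where open ≤-Reasoning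
overlapCount-bound {suc n} (outside ∷ᵥ A) (suc t) (suc s) = begin
    overlapCount (outside ∷ᵥ A) (suc t + suc s) (suc t)
      ≡⟨ count-allSubsets-suc n _ ⟩
    overlapCount A (t + suc s) (suc t) + overlapCount A (suc t + suc s) (suc t)
      ≡⟨ cong (λ k → overlapCount A k (suc t) + overlapCount A (suc t + suc s) (suc t)) (+-suc t s) ⟩
    overlapCount A (suc t + s) (suc t) + overlapCount A (suc t + suc s) (suc t)
      ≤⟨ +-mono-≤ (overlapCount-bound A (suc t) s) (overlapCount-bound A (suc t) (suc s)) ⟩
    (a C suc t) * ((n ∸ suc t) C s) + (a C suc t) * ((n ∸ suc t) C suc s)
      ≡⟨ *-distribˡ-+ (a C suc t) _ _ ⟨
    (a C suc t) * ((n ∸ suc t) C s + (n ∸ suc t) C suc s)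
      ≡⟨ cong ((a C suc t) *_) (pascal (n ∸ suc t) s) ⟩
    (a C suc t) * (suc (n ∸ suc t) C suc s)
      ≤⟨ C-shift t (suc s) (∣p∣≤n A) ⟩
    (a C suc t) * ((n ∸ t) C suc s) ∎
  where
  open ≤-Reasoning
  a = ∣ A ∣

shares3 : ∀ {n} → Subset n → Subset n → Bool
shares3 A B = 3 ≤ᵇ ∣ A ∩ B ∣

shares3-sym : ∀ {n} (A B : Subset n) → shares3 A B ≡ shares3 B A
shares3-sym A B = cong (λ X → 3 ≤ᵇ ∣ X ∣) (∩-comm A B)

badCount-≤ : ∀ r n → badCount r n ≤ count (Collisions.collides shares3 (rSubsets r n)) (configs r n)
badCount-≤ r n = ≤-trans (≤-reflexive (length-filter bad? (configs r n))) (count-mono bad⇒collides (configs r n))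
  where
  open Collisions shares3 (rSubsets r n) using (collides; collides-complete)
  bad⇒collides : (G : BipGraph n) → T (does (bad? G)) → T (collides G)
  bad⇒collides G h with bad? G
  ... | yes (i , j , i≢j , shared) = collides-complete shares3-sym G i j i≢j (≤⇒≤ᵇ shared)

partners-bound : ∀ s n → All (λ A → count (shares3 A) (rSubsets (3 + s) n) ≤ ((3 + s) C 3) * ((n ∸ 3) C s)) (rSubsets (3 + s) n)
partners-bound s n = All-map (λ {A} → bound {A}) (all-filter (λ B → ∣ B ∣ ≟ 3 + s) (allSubsets n))
  where
  bound : ∀ {A} → ∣ A ∣ ≡ 3 + s → count (shares3 A) (rSubsets (3 + s) n) ≤ ((3 + s) C 3) * ((n ∸ 3) C s)
  bound {A} size = begin
    count (shares3 A) (rSubsets (3 + s) n) ≡⟨ count-filter (λ B → ∣ B ∣ ≟ 3 + s) (shares3 A) (allSubsets n) ⟩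
    overlapCount A (3 + s) 3               ≤⟨ overlapCount-bound A 3 s ⟩
    (∣ A ∣ C 3) * ((n ∸ 3) C s)            ≡⟨ cong (λ a → (a C 3) * ((n ∸ 3) C s)) size ⟩
    ((3 + s) C 3) * ((n ∸ 3) C s)          ∎
    where open ≤-Reasoning

totalCount-≡ : ∀ r n → totalCount r n ≡ (n C r) ^ n
totalCount-≡ r n = trans (length-allVecs (rSubsets r n) n) (cong (_^ n) (length-rSubsets r n))

totalCount-pos : ∀ {r n} → r ≤ n → 0 < totalCount r n
totalCount-pos {r} {n} r≤n = subst (0 <_) (sym (totalCount-≡ r n)) (m^n>0 (n C r) {{>-nonZero (C-pos r≤n)}} n)

collisionConstant : ℕ → ℕ
collisionConstant s = ((3 + s) C 3) * ((3 + s) * (2 + s) * (1 + s))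

-- Multiply by n · ((n-3) C (r-3)), which absorption turns into (n C r) · r(r-1)(r-2),
-- apply the union bound, and cancel that positive factor again.
bad-fraction : ∀ s m → s ≤ m →
  badCount (3 + s) (3 + m) * ((1 + m) * (2 + m)) ≤ (3 + m) * collisionConstant s * totalCount (3 + s) (3 + m)
bad-fraction s m s≤m = *-cancelʳ-≤ _ _ (n * (m C s)) {{m*n≢0 n (m C s) {{_}} {{>-nonZero (C-pos s≤m)}}}} (begin
    b * Q * (n * (m C s))                 ≡⟨ regroup b m (m C s) ⟩
    b * (n * (2 + m) * (1 + m) * (m C s)) ≡⟨ cong (b *_) (C-absorb³ m s) ⟨
    b * ((n C r) * P)                     ≡⟨ cong (λ z → b * (z * P)) (length-rSubsets r n) ⟨
    b * (M * P)                           ≤⟨ *-monoˡ-≤ (M * P) (badCount-≤ r n) ⟩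
    b′ * (M * P)                          ≡⟨ *-assoc b′ M P ⟨
    b′ * M * P                            ≤⟨ *-monoˡ-≤ P (collides-bound (partners-bound s n) n) ⟩
    n * n * (B₃ * (m C s)) * M ^ n * P    ≡⟨ cong (λ z → n * n * (B₃ * (m C s)) * z * P) (length-allVecs L n) ⟨
    n * n * (B₃ * (m C s)) * total * P    ≡⟨ collect n B₃ (m C s) total P ⟩
    n * (B₃ * P) * total * (n * (m C s))  ∎)
  where
  open ≤-Reasoning
  r = 3 + s
  n = 3 + m
  L = rSubsets r n
  open Collisions shares3 L using (M; collides; collides-bound)
  Q = (1 + m) * (2 + m)
  P = (3 + s) * (2 + s) * (1 + s)
  B₃ = r C 3
  total = totalCount r n
  b = badCount r n
  b′ = count collides (configs r n)
  regroup : ∀ b m c → b * ((1 + m) * (2 + m)) * ((3 + m) * c) ≡ b * ((3 + m) * (2 + m) * (1 + m) * c)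
  regroup = solve-∀
  collect : ∀ n B c t P → n * n * (B * c) * t * P ≡ n * (B * P) * t * (n * c)
  collect = solve-∀

below-one : ∀ {b c total} m → c ≤ m → 0 < total → b * ((1 + m) * (2 + m)) ≤ (3 + m) * c * total → b < total
below-one {b} {c} {total} m c≤m total>0 bound = *-cancelʳ-< Q b total (begin-strict
    b * Q           ≤⟨ bound ⟩
    (3 + m) * c * total <⟨ *-monoˡ-< total {{>-nonZero total>0}} small ⟩
    Q * total           ≡⟨ *-comm Q total ⟩
    total * Q           ∎)
  where
  open ≤-Reasoning
  Q = (1 + m) * (2 + m)
  expand : ∀ m → (3 + m) * m + 2 ≡ (1 + m) * (2 + m)
  expand = solve-∀
  small : (3 + m) * c < Q
  small = begin-strict
    (3 + m) * c     ≤⟨ *-monoʳ-≤ (3 + m) c≤m ⟩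
    (3 + m) * m     <⟨ m<m+n _ (s≤s z≤n) ⟩
    (3 + m) * m + 2 ≡⟨ expand m ⟩
    Q               ∎

collisions-rare : ∀ s k → ∃[ N ] ((n : ℕ) → N ≤ n → 3 + s ≤ n → suc k * badCount (3 + s) n < totalCount (3 + s) n)
collisions-rare s k = 3 + c , bound
  where
  c = suc k * collisionConstant s
  bound : (n : ℕ) → 3 + c ≤ n → 3 + s ≤ n → suc k * badCount (3 + s) n < totalCount (3 + s) n
  bound (suc (suc (suc m))) (s≤s (s≤s (s≤s c≤m))) r≤n@(s≤s (s≤s (s≤s s≤m))) =
    below-one m c≤m (totalCount-pos r≤n) (begin
      suc k * b * Q                                 ≡⟨ *-assoc (suc k) b Q ⟩
      suc k * (b * Q)                               ≤⟨ *-monoʳ-≤ (suc k) (bad-fraction s m s≤m) ⟩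
      suc k * ((3 + m) * collisionConstant s * total)   ≡⟨ regroup (suc k) (3 + m) (collisionConstant s) total ⟩
      (3 + m) * c * total                               ∎)
    where
    open ≤-Reasoning
    b = badCount (3 + s) (3 + m)
    total = totalCount (3 + s) (3 + m)
    Q = (1 + m) * (2 + m)
    regroup : ∀ k n c t → k * (n * c * t) ≡ n * (k * c) * t
    regroup = solve-∀

lemma11 : (r : ℕ) → 10 ≤ r → (k : ℕ) → ∃[ N ] ((n : ℕ) → N ≤ n → 4 * r ≤ n → suc k * badCount r n < totalCount r n)
lemma11 r 10≤r k with m≤n⇒∃[o]m+o≡n (≤-trans (s≤s (s≤s (s≤s z≤n))) 10≤r)
... | s , refl with collisions-rare s k
...   | N , rare = N , λ n N≤n 4r≤n → rare n N≤n (≤-trans (m≤m+n (3 + s) (3 * (3 + s))) 4r≤n)
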